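{- Let $n\ge 2$ and let $\pi\in S_n$ with $\pi_1=n$ or $\pi_1=n-1$. Then: (1) $T^{ -k}(\pi)=\operatorname{rev}(T^{k+1}(\pi))$ for every integer $k$. (2) The orbit of $\pi$ has even size. Equivalently, if a topdrop-valid necklace in $S_n$ contains $n$ and/or $n-1$, then it has even size. (3) Writing $2m$ for the size of the orbit of $\pi$, we have $T^{m}(\pi)_1=n$ or $T^{m}(\pi)_1=n-1$; moreover, among the $2m$ entries of the topdrop-necklace of $\pi$, exactly two are equal to $n$ or $n-1$. (4) There are exactly $(n-1)!$ orbits in $S_n$ whose topdrop-necklaces contain $n$ and/or $n-1$.
   Context: Permutations are in one-line notation $\pi=\pi_1\cdots\pi_n$; $\operatorname{rev}(\pi)=\pi_n\cdots\pi_1$. The topdrop map $T:S_n\to S_n$ is $T(\pi_1\cdots\pi_n)=\pi_{\pi_1+1}\cdots\pi_n\,\pi_{\pi_1}\pi_{\pi_1-1}\cdots\pi_1$ (first $\pi_1$ entries removed, reversed, appended at the end); it is a bijection, and $T^{k}$ for integer $k$ denotes iterates of $T$ or $T^{ -1}$. The orbit of $\pi$ is the sequence $(\pi,T(\pi),\dots,T^{s-1}(\pi))$ where $s\ge1$ is minimal with $T^s(\pi)=\pi$; $s$ is its size. The topdrop-necklace of $\pi$ is the cyclic sequence $[\pi_1,T(\pi)_1,\dots,T^{s-1}(\pi)_1]$ of first entries along the orbit, considered up to cyclic rotation; its size is $s$. A necklace is topdrop-valid in $S_n$ if it is the topdrop-necklace of some $\pi\in S_n$. -}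

module Defs where

open import Data.Nat using (ℕ; zero; suc; _≤_; _<_; _∸_)
open import Data.Integer using (ℤ; +_; -[1+_])
open import Data.List using (List; []; _∷_; _++_; take; drop; reverse; applyUpTo; map; upTo)
open import Data.List.Relation.Binary.Permutation.Propositional using (_↭_)
open import Data.List.Relation.Unary.Any using (Any)
open import Data.Product using (Σ; _×_; ∃-syntax)
open import Data.Sum using (_⊎_)
open import Relation.Binary.PropositionalEquality using (_≡_; _≢_)

-- one-line notation: a permutation of S_n is a list of the values 1..n in some order
oneToN : ℕ → List ℕ
oneToN n = applyUpTo suc n

InS : ℕ → List ℕ → Set
InS n π = π ↭ oneToN n

-- first entry π₁ (default 0 on the empty list, never used for n ≥ 1)
first : List ℕ → ℕ
first []      = 0
first (x ∷ _) = x

rev : List ℕ → List ℕ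
rev = reverse

topdrop : List ℕ → List ℕ
topdrop π = drop (first π) π ++ reverse (take (first π) π)

-- inverse of topdrop: the last entry σ_n equals π₁ = a, and the last a entries
-- of σ are π_a ⋯ π₁; so π = rev(last a of σ) ++ (first n-a of σ).
topdropInv : List ℕ → List ℕ
topdropInv σ = take (first (reverse σ)) (reverse σ)
            ++ reverse (drop (first (reverse σ)) (reverse σ))

iter : ℕ → (List ℕ → List ℕ) → List ℕ → List ℕ
iter zero    f x = x
iter (suc k) f x = f (iter k f x)

Tpow : ℤ → List ℕ → List ℕ
Tpow (+ k)      π = iter k topdrop π
Tpow -[1+ k ]   π = iter (suc k) topdropInv π

OrbitSize : List ℕ → ℕ → Set
OrbitSize π s =
  (1 ≤ s) × (iter s topdrop π ≡ π) ×
  (∀ t → 1 ≤ t → t < s → iter t topdrop π ≢ π)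

-- topdrop-necklace of π (of size s), represented by the list of first entries
-- π₁, T(π)₁, …, T^{s-1}(π)₁ (one representative of the rotation class)
necklace : List ℕ → ℕ → List ℕ
necklace π s = map (λ i → first (iter i topdrop π)) (upTo s)

IsTop : ℕ → ℕ → Set
IsTop n x = (x ≡ n) ⊎ (x ≡ n ∸ 1)

NecklaceHasTop : ℕ → List ℕ → Set
NecklaceHasTop n π = Σ ℕ λ s → OrbitSize π s × Any (IsTop n) (necklace π s)

SameOrbit : List ℕ → List ℕ → Set
SameOrbit π σ = ∃[ k ] iter k topdrop π ≡ σ

open import Data.Nat using (_≟_)
open import Data.List using (length; filter)
open import Relation.Nullary.Decidable using (Dec; _⊎-dec_)

isTop? : (n x : ℕ) → Dec (IsTop n x)
isTop? n x = (x ≟ n) ⊎-dec (x ≟ n ∸ 1)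

countTop : ℕ → List ℕ → ℕ
countTop n l = length (filter (isTop? n) l)

module Submission where

-- If π₁ ∈ {n, n-1}, dropping π₁ entries leaves at most one, so T π = rev π; and on S_n
-- T ∘ rev ∘ T = rev. Hence T^k(rev(T^(k+1) π)) = π, which is (1) and, for an orbit of
-- size s, gives rev(T^(i+1) π) = T^j π whenever i + j = s. An odd s would make
-- T^((s+1)/2) π a palindrome of length n ≥ 2 with distinct entries. For s = 2m, T^m π
-- is fixed by rev ∘ T, which forces its first entry to be n or n-1; conversely a first
-- entry n or n-1 at position 0 < r < s gives T^r π = rev(T^(r+1) π) = T^(s-r) π, so
-- r = m. Thus every such orbit meets the 2 (n-1)! permutations starting with n or n-1
-- in exactly one pair {ρ, T^m ρ}; keeping the lexicographically smaller element of each
-- pair leaves (n-1)! representatives.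

module ListCombinatorics where

  open import Data.Empty using (⊥-elim)
  open import Data.List using (List; []; _∷_; _++_; _∷ʳ_; [_]; take; drop; reverse; length; map; filter; concatMap)
  open import Data.List.Properties
    using (∷-injectiveˡ; ∷-injectiveʳ; unfold-reverse; length-++; length-map; filter-accept; filter-reject; filter-all)
  open import Data.List.Membership.Propositional using (_∈_; _∉_; find)
  open import Data.List.Membership.Propositional.Properties
    using (∈-++⁺ˡ; ∈-++⁺ʳ; ∈-++⁻; ∈-map⁺; ∈-map⁻; ∈-filter⁺; ∈-filter⁻; ∈-∃++; ∈-concatMap⁺; ∈-concatMap⁻)
  open import Data.List.Membership.Propositional.Properties.WithK using (unique∧set⇒bag)
  open import Data.List.Relation.Binary.BagAndSetEquality using (∼bag⇒↭)
  open import Data.List.Relation.Binary.Permutation.Propositional using (_↭_; ↭-refl; ↭-prep; ↭-swap; ↭-trans; ↭-sym)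
  open import Data.List.Relation.Binary.Permutation.Propositional.Properties
    using (↭-length; ↭-empty-inv; ∈-resp-↭; drop-mid)
  open import Data.List.Relation.Unary.All as All using ([]; _∷_)
  open import Data.List.Relation.Unary.All.Properties using (¬Any⇒All¬; All¬⇒¬Any) renaming (map⁺ to All-map⁺)
  open import Data.List.Relation.Unary.AllPairs using (AllPairs; []; _∷_)
  import Data.List.Relation.Unary.AllPairs.Properties as AllPairsₚ
  open import Data.List.Relation.Unary.Any as Any using (here; there)
  open import Data.List.Relation.Unary.Unique.Propositional using (Unique)
  open import Data.List.Relation.Unary.Unique.Propositional.Properties
    using (++⁺; filter⁺; concat⁺) renaming (map⁺ to Unique-map⁺)
  open import Data.Nat using (ℕ; zero; suc; _+_; _*_; _≤_; _<_; z≤n; s≤s; _!)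
  open import Data.Nat.Properties using (n≮0; ≤-pred; *-comm; +-identityʳ)
  open import Data.Product using (_×_; _,_; proj₁)
  open import Data.Sum using (_⊎_; inj₁; inj₂)
  open import Function using (_∘_; _⇔_; mk⇔)
  open import Level using (Level)
  open import Relation.Binary using (Rel; Decidable; DecidableEquality; Asymmetric)
  open import Relation.Binary.PropositionalEquality
    using (_≡_; _≢_; refl; sym; trans; cong; cong₂; subst; module ≡-Reasoning)
  open import Relation.Nullary using (¬_; yes; no; contradiction; ¬?)
  import Relation.Unary as U

  private
    variable
      a ℓ : Level
      A B : Set a
      xs ys : List A

  take-take-++ : ∀ n (xs ys : List A) → n ≤ length xs → take n (take n xs ++ ys) ≡ take n xs
  take-take-++ zero    xs       ys _        = refl
  take-take-++ (suc n) (x ∷ xs) ys (s≤s n≤) = cong (x ∷_) (take-take-++ n xs ys n≤)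

  drop-take-++ : ∀ n (xs ys : List A) → n ≤ length xs → drop n (take n xs ++ ys) ≡ ys
  drop-take-++ zero    xs       ys _        = refl
  drop-take-++ (suc n) (x ∷ xs) ys (s≤s n≤) = drop-take-++ n xs ys n≤

  reverse-length≤1 : length xs ≤ 1 → reverse xs ≡ xs
  reverse-length≤1 {xs = []}        _        = refl
  reverse-length≤1 {xs = _ ∷ []}    _        = refl
  reverse-length≤1 {xs = _ ∷ _ ∷ _} (s≤s ())

  unique-palindrome⇒length≤1 : Unique xs → reverse xs ≡ xs → length xs ≤ 1
  unique-palindrome⇒length≤1 {xs = []}         _        _    = z≤n
  unique-palindrome⇒length≤1 {xs = _ ∷ []}     _        _    = s≤s z≤n
  unique-palindrome⇒length≤1 {xs = x ∷ y ∷ zs} (x∉ ∷ _) rev≡ =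
    ⊥-elim (All¬⇒¬Any x∉ (last∈tail (reverse (y ∷ zs)) (trans (sym rev≡) (unfold-reverse x (y ∷ zs)))))
    where
    last∈tail : ∀ (cs : List _) {a b bs d} → a ∷ b ∷ bs ≡ cs ∷ʳ d → d ∈ b ∷ bs
    last∈tail []       ()
    last∈tail (c ∷ cs) eq = subst (_ ∈_) (sym (∷-injectiveʳ eq)) (∈-++⁺ʳ cs (here refl))

  length-filter-map : ∀ {p} {P : U.Pred B p} (P? : U.Decidable P) (f : A → B) xs →
                      length (filter P? (map f xs)) ≡ length (filter (P? ∘ f) xs)
  length-filter-map P? f []       = refl
  length-filter-map P? f (x ∷ xs) with P? (f x)
  ... | yes _ = cong suc (length-filter-map P? f xs)
  ... | no  _ = length-filter-map P? f xs

  length-unique-∼set : Unique xs → Unique ys → (∀ {z} → z ∈ xs ⇔ z ∈ ys) → length xs ≡ length ys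
  length-unique-∼set xs-unique ys-unique xs∼ys = ↭-length (∼bag⇒↭ (unique∧set⇒bag xs-unique ys-unique xs∼ys))

  AllPairs-map-∈ : ∀ {r s} {R : Rel A r} {S : Rel A s} →
                   (∀ {x y} → x ∈ xs → y ∈ xs → R x y → S x y) → AllPairs R xs → AllPairs S xs
  AllPairs-map-∈ h []         = []
  AllPairs-map-∈ h (Rx ∷ Rxs) =
    All.tabulate (λ y∈ → h (here refl) (there y∈) (All.lookup Rx y∈))
    ∷ AllPairs-map-∈ (λ p q → h (there p) (there q)) Rxs

  map⁺-injectiveOn : {f : A → B} → (∀ {x y} → x ∈ xs → y ∈ xs → f x ≡ f y → x ≡ y) →
                     Unique xs → Unique (map f xs)
  map⁺-injectiveOn f-injective = AllPairsₚ.map⁺ ∘ AllPairs-map-∈ (λ x∈ y∈ x≢y → x≢y ∘ f-injective x∈ y∈)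

  Unique-concatMap : ∀ {f : A → List B} → Unique xs → (∀ {x} → x ∈ xs → Unique (f x)) →
                     (∀ {x y z} → x ∈ xs → y ∈ xs → z ∈ f x → z ∈ f y → x ≡ y) →
                     Unique (concatMap f xs)
  Unique-concatMap xs-unique f-unique f-disjoint = concat⁺ (All-map⁺ (All.tabulate f-unique))
    (AllPairsₚ.map⁺ (AllPairs-map-∈ (λ x∈ y∈ x≢y (z∈fx , z∈fy) → x≢y (f-disjoint x∈ y∈ z∈fx z∈fy)) xs-unique))

  length-concatMap : ∀ (f : A → List B) {c} xs → (∀ {x} → x ∈ xs → length (f x) ≡ c) →
                     length (concatMap f xs) ≡ length xs * c
  length-concatMap f []       _ = refl
  length-concatMap f (x ∷ xs) h = trans (length-++ (f x)) (cong₂ _+_ (h (here refl)) (length-concatMap f xs (h ∘ there)))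

  insertions : A → List A → List (List A)
  insertions x []       = [ [ x ] ]
  insertions x (y ∷ ys) = (x ∷ y ∷ ys) ∷ map (y ∷_) (insertions x ys)

  permutations : List A → List (List A)
  permutations []       = [ [] ]
  permutations (x ∷ xs) = concatMap (insertions x) (permutations xs)

  length-insertions : ∀ (x : A) ys → length (insertions x ys) ≡ suc (length ys)
  length-insertions x []       = refl
  length-insertions x (y ∷ ys) = cong suc (trans (length-map (y ∷_) (insertions x ys)) (length-insertions x ys))

  ∈-insertions⁺ : ∀ (x : A) us vs → us ++ x ∷ vs ∈ insertions x (us ++ vs)
  ∈-insertions⁺ x []       []       = here refl
  ∈-insertions⁺ x []       (v ∷ vs) = here refl
  ∈-insertions⁺ x (u ∷ us) vs       = there (∈-map⁺ (u ∷_) (∈-insertions⁺ x us vs))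

  ∈-insertions⁻ : ∀ {ρ} (x : A) ys → ρ ∈ insertions x ys → ρ ↭ x ∷ ys
  ∈-insertions⁻ x []       (here refl) = ↭-refl
  ∈-insertions⁻ x (y ∷ ys) (here refl) = ↭-refl
  ∈-insertions⁻ x (y ∷ ys) (there ρ∈) with ∈-map⁻ (y ∷_) ρ∈
  ... | ρ′ , ρ′∈ , refl = ↭-trans (↭-prep y (∈-insertions⁻ x ys ρ′∈)) (↭-swap y x ↭-refl)

  insertions-unique : ∀ (x : A) ys → x ∉ ys → Unique (insertions x ys)
  insertions-unique x []       _  = [] ∷ []
  insertions-unique x (y ∷ ys) x∉ =
    ¬Any⇒All¬ _ head∉ ∷ Unique-map⁺ ∷-injectiveʳ (insertions-unique x ys (x∉ ∘ there))
    where
    head∉ : x ∷ y ∷ ys ∉ map (y ∷_) (insertions x ys)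
    head∉ p with ∈-map⁻ (y ∷_) p
    ... | _ , _ , eq = x∉ (here (∷-injectiveˡ eq))

  ∈-permutations⁻ : ∀ {ρ} (xs : List A) → ρ ∈ permutations xs → ρ ↭ xs
  ∈-permutations⁻ []       (here refl) = ↭-refl
  ∈-permutations⁻ (x ∷ xs) ρ∈ with find (∈-concatMap⁻ (insertions x) ρ∈)
  ... | ys , ys∈ , ρ∈ins = ↭-trans (∈-insertions⁻ x ys ρ∈ins) (↭-prep x (∈-permutations⁻ xs ys∈))

  ∈-permutations⁺ : ∀ {ρ} {xs : List A} → ρ ↭ xs → ρ ∈ permutations xs
  ∈-permutations⁺ {xs = []}     ρ↭[] rewrite ↭-empty-inv ρ↭[] = here refl
  ∈-permutations⁺ {xs = x ∷ xs} ρ↭ with ∈-∃++ (∈-resp-↭ (↭-sym ρ↭) (here refl))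
  ... | us , vs , refl = ∈-concatMap⁺ (insertions x)
    (Any.map (λ where refl → ∈-insertions⁺ x us vs) (∈-permutations⁺ {xs = xs} (drop-mid us [] ρ↭)))

  length-permutations : ∀ (xs : List A) → length (permutations xs) ≡ length xs !
  length-permutations []       = refl
  length-permutations (x ∷ xs) = begin
    length (concatMap (insertions x) (permutations xs)) ≡⟨ length-concatMap (insertions x) (permutations xs) length-ins ⟩
    length (permutations xs) * suc (length xs)          ≡⟨ cong (_* suc (length xs)) (length-permutations xs) ⟩
    length xs ! * suc (length xs)                       ≡⟨ *-comm (length xs !) (suc (length xs)) ⟩
    suc (length xs) * length xs !                       ∎
    where
    open ≡-Reasoning
    length-ins : ∀ {ys} → ys ∈ permutations xs → length (insertions x ys) ≡ suc (length xs)
    length-ins {ys} ys∈ = trans (length-insertions x ys) (cong suc (↭-length (∈-permutations⁻ xs ys∈)))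

  module _ (_≟_ : DecidableEquality A) where

    remove : A → List A → List A
    remove x = filter (λ y → ¬? (x ≟ y))

    private
      remove-head : ∀ (x : A) ys → x ∉ ys → remove x (x ∷ ys) ≡ ys
      remove-head x ys x∉ =
        trans (filter-reject (λ y → ¬? (x ≟ y)) (λ x≢x → x≢x refl)) (filter-all _ (¬Any⇒All¬ ys x∉))

    remove-insertions : ∀ {ρ} (x : A) ys → x ∉ ys → ρ ∈ insertions x ys → remove x ρ ≡ ys
    remove-insertions x []       x∉ (here refl) = remove-head x [] x∉
    remove-insertions x (y ∷ ys) x∉ (here refl) = remove-head x (y ∷ ys) x∉
    remove-insertions x (y ∷ ys) x∉ (there ρ∈) with ∈-map⁻ (y ∷_) ρ∈
    ... | ρ′ , ρ′∈ , refl = trans (filter-accept (λ y → ¬? (x ≟ y)) (x∉ ∘ here))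
                                  (cong (y ∷_) (remove-insertions x ys (x∉ ∘ there) ρ′∈))

    permutations-unique : ∀ {xs : List A} → Unique xs → Unique (permutations xs)
    permutations-unique {xs = []}     _        = [] ∷ []
    permutations-unique {xs = x ∷ xs} (x∉ ∷ xs-unique) =
      Unique-concatMap (permutations-unique xs-unique) (λ ys∈ → insertions-unique x _ (x∉ys ys∈))
        (λ ys∈ ys′∈ ρ∈ ρ∈′ → trans (sym (remove-insertions x _ (x∉ys ys∈) ρ∈))
                                   (remove-insertions x _ (x∉ys ys′∈) ρ∈′))
      where
      x∉ys : ∀ {ys} → ys ∈ permutations xs → x ∉ ys
      x∉ys ys∈ x∈ = All¬⇒¬Any x∉ (∈-resp-↭ (∈-permutations⁻ xs ys∈) x∈)

  module _ {_≺_ : Rel A ℓ} (_≺?_ : Decidable _≺_) (≺-asym : Asymmetric _≺_)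
           (≺-connex : ∀ {x y} → x ≢ y → x ≺ y ⊎ y ≺ x)
           {φ : A → A} {xs : List A} (xs-unique : Unique xs)
           (φ-closed : ∀ {x} → x ∈ xs → φ x ∈ xs)
           (φ-involutive : ∀ {x} → x ∈ xs → φ (φ x) ≡ x)
           (φ-fixedPointFree : ∀ {x} → x ∈ xs → φ x ≢ x) where

    private
      lower : List A
      lower = filter (λ x → x ≺? φ x) xs

      lower⁻ : ∀ {x} → x ∈ lower → x ∈ xs × x ≺ φ x
      lower⁻ = ∈-filter⁻ (λ x → x ≺? φ x)

      φ-lower⁺ : ∀ {x} → x ∈ xs → φ x ≺ x → φ x ∈ lower
      φ-lower⁺ {x} x∈ φx≺x =
        ∈-filter⁺ (λ x → x ≺? φ x) (φ-closed x∈) (subst (φ x ≺_) (sym (φ-involutive x∈)) φx≺x)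

      lower++φlower⇔xs : ∀ {z} → z ∈ lower ++ map φ lower ⇔ z ∈ xs
      lower++φlower⇔xs = mk⇔ to from
        where
        to : ∀ {z} → z ∈ lower ++ map φ lower → z ∈ xs
        to z∈ with ∈-++⁻ lower z∈
        ... | inj₁ z∈lower   = proj₁ (lower⁻ z∈lower)
        ... | inj₂ z∈φlower with ∈-map⁻ φ z∈φlower
        ...   | y , y∈ , refl = φ-closed (proj₁ (lower⁻ y∈))
        from : ∀ {z} → z ∈ xs → z ∈ lower ++ map φ lower
        from {z} z∈ with z ≺? φ z
        ... | yes z≺φz = ∈-++⁺ˡ (∈-filter⁺ (λ x → x ≺? φ x) z∈ z≺φz)
        ... | no  z⊀φz with ≺-connex (φ-fixedPointFree z∈ ∘ sym)
        ...   | inj₁ z≺φz = contradiction z≺φz z⊀φz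
        ...   | inj₂ φz≺z =
          ∈-++⁺ʳ lower (subst (_∈ map φ lower) (φ-involutive z∈) (∈-map⁺ φ (φ-lower⁺ z∈ φz≺z)))

      lower++φlower-unique : Unique (lower ++ map φ lower)
      lower++φlower-unique = ++⁺ (filter⁺ _ xs-unique) (map⁺-injectiveOn φ-injective (filter⁺ _ xs-unique)) disjoint
        where
        φ-injective : ∀ {x y} → x ∈ lower → y ∈ lower → φ x ≡ φ y → x ≡ y
        φ-injective x∈ y∈ φx≡φy = trans (sym (φ-involutive (proj₁ (lower⁻ x∈))))
                                        (trans (cong φ φx≡φy) (φ-involutive (proj₁ (lower⁻ y∈))))
        disjoint : ∀ {z} → ¬ (z ∈ lower × z ∈ map φ lower)
        disjoint (z∈ , z∈φlower) with ∈-map⁻ φ z∈φlower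
        ... | y , y∈ , refl with lower⁻ y∈ | lower⁻ z∈
        ...   | y∈xs , y≺φy | _ , φy≺φφy = ≺-asym y≺φy (subst (φ y ≺_) (φ-involutive y∈xs) φy≺φφy)

    length-filter-≺-involution : 2 * length (filter (λ x → x ≺? φ x) xs) ≡ length xs
    length-filter-≺-involution = begin
      2 * length lower                    ≡⟨ cong (length lower +_) (+-identityʳ (length lower)) ⟩
      length lower + length lower         ≡⟨ cong (length lower +_) (length-map φ lower) ⟨
      length lower + length (map φ lower) ≡⟨ length-++ lower ⟨
      length (lower ++ map φ lower)       ≡⟨ length-unique-∼set lower++φlower-unique xs-unique lower++φlower⇔xs ⟩
      length xs                           ∎
      where open ≡-Reasoning

  -- least P? b is the least i < b satisfying P, and b itself if there is none.
  least : ∀ {p} {P : U.Pred ℕ p} → U.Decidable P → ℕ → ℕ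
  least P? zero    = zero
  least P? (suc b) with P? zero
  ... | yes _ = zero
  ... | no  _ = suc (least (P? ∘ suc) b)

  least-satisfies : ∀ {p} {P : U.Pred ℕ p} (P? : U.Decidable P) b {i} → i < b → P i → P (least P? b)
  least-satisfies P? (suc b) {zero}  _         P0 with P? zero
  ... | yes _   = P0
  ... | no  ¬P0 = contradiction P0 ¬P0
  least-satisfies P? (suc b) {suc i} (s≤s i<b) Pi with P? zero
  ... | yes P0 = P0
  ... | no  _  = least-satisfies (P? ∘ suc) b i<b Pi

  least-minimal : ∀ {p} {P : U.Pred ℕ p} (P? : U.Decidable P) b {j} → j < least P? b → ¬ P j
  least-minimal P? (suc b) {j}     j< with P? zero
  least-minimal P? (suc b) {j}     j< | yes _   = contradiction j< n≮0
  least-minimal P? (suc b) {zero}  _  | no  ¬P0 = ¬P0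
  least-minimal P? (suc b) {suc j} j< | no  _   = least-minimal (P? ∘ suc) b (≤-pred j<)

module Topdrop where

  open import Defs
  open ListCombinatorics

  open import Data.Fin using (toℕ)
  open import Data.Fin.Properties using (pigeonhole; toℕ<n)
  open import Data.Integer using (-[1+_])
  import Data.Integer as ℤ
  open import Data.List using (List; []; _∷_; _++_; _∷ʳ_; [_]; take; drop; reverse; length; map; filter; upTo; lookup)
  open import Data.List.Properties
    using ( ∷-injectiveˡ; ∷-injectiveʳ; ++-assoc; ++-cancelˡ; length-++; length-map; length-drop; length-applyUpTo
          ; applyUpTo-∷ʳ; reverse-++; reverse-involutive; reverse-injective; take++drop≡id; ≡-dec)
  open import Data.List.Membership.Propositional using (_∈_; find; lose)
  open import Data.List.Membership.Propositional.Properties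
    using (∈-map⁺; ∈-map⁻; ∈-++⁺ˡ; ∈-++⁺ʳ; ∈-++⁻; ∈-applyUpTo⁻; ∈-upTo⁺; ∈-upTo⁻; ∈-filter⁺; ∈-filter⁻)
  open import Data.List.Relation.Binary.Lex.Strict using (Lex-<)
  import Data.List.Relation.Binary.Lex.Strict as Lex
  open import Data.List.Relation.Binary.Permutation.Propositional
    using (_↭_; ↭-sym; ↭-trans; ↭-prep; ↭⇒↭ₛ; module PermutationReasoning)
  open import Data.List.Relation.Binary.Permutation.Propositional.Properties
    using (↭-length; ↭-reverse; ∈-resp-↭; ++-comm; ++⁺ʳ; shift; ∷↭∷ʳ; drop-∷)
  open import Data.List.Relation.Binary.Pointwise using (Pointwise-≡⇒≡)
  open import Data.List.Relation.Unary.All as All using (All; []; _∷_)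
  open import Data.List.Relation.Unary.AllPairs as AllPairs using (AllPairs; []; _∷_)
  open import Data.List.Relation.Unary.Any as Any using (Any; here; there)
  import Data.List.Relation.Unary.Any.Properties as Any
  open import Data.List.Relation.Unary.Any.Properties using (lookup-index)
  open import Data.List.Relation.Unary.Unique.Propositional using (Unique)
  open import Data.List.Relation.Unary.Unique.Propositional.Properties
    using (applyUpTo⁺₁; upTo⁺; drop⁺; filter⁺; ++⁺) renaming (map⁺ to Unique-map⁺)
  open import Data.Nat using (ℕ; zero; suc; _+_; _*_; _∸_; _/_; _≤_; _<_; z≤n; s≤s; z<s; _≟_; _!)
  open import Data.Nat.DivMod using (m*n/n≡m)
  open import Data.Nat.Properties
  open import Data.Product using (∃-syntax; _×_; _,_; proj₁; proj₂)
  open import Data.Sum using (_⊎_; inj₁; inj₂)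
  open import Function using (_∘_; _⇔_; mk⇔)
  open import Level using (0ℓ)
  open import Relation.Binary using (Rel; Decidable; Asymmetric; tri<; tri≈; tri>)
  open import Relation.Binary.PropositionalEquality
    using (setoid; resp₂; _≡_; _≢_; refl; sym; trans; cong; cong₂; subst; subst₂; module ≡-Reasoning)
  open import Data.List.Relation.Binary.Permutation.Setoid.Properties (setoid ℕ) using (Unique-resp-↭)
  open import Relation.Nullary using (¬_; Dec; yes; no; contradiction)

  2*m≡m+m : ∀ m → 2 * m ≡ m + m
  2*m≡m+m m = cong (m +_) (+-identityʳ m)

  even-or-odd : ∀ s → (∃[ m ] s ≡ 2 * m) ⊎ (∃[ m ] s ≡ suc (2 * m))
  even-or-odd zero    = inj₁ (0 , refl)
  even-or-odd (suc s) with even-or-odd s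
  ... | inj₁ (m , s≡2m)   = inj₂ (m , cong suc s≡2m)
  ... | inj₂ (m , s≡1+2m) = inj₁ (suc m , cong suc (trans s≡1+2m (sym (+-suc m (m + 0)))))

  IsTop⇒∸≤1 : ∀ n {a} → IsTop n a → n ∸ a ≤ 1
  IsTop⇒∸≤1 n       (inj₁ refl) = subst (_≤ 1) (sym (n∸n≡0 n)) z≤n
  IsTop⇒∸≤1 zero    (inj₂ refl) = z≤n
  IsTop⇒∸≤1 (suc n) (inj₂ refl) = ≤-reflexive (m∸[m∸n]≡n {suc n} (s≤s z≤n))

  ∸≤1⇒IsTop : ∀ {n a} → a ≤ n → n ∸ a ≤ 1 → IsTop n a
  ∸≤1⇒IsTop {n} {a} a≤n n∸a≤1 with n ∸ a in n∸a≡
  ... | zero        = inj₁ (≤-antisym a≤n (m∸n≡0⇒m≤n n∸a≡))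
  ... | suc zero    = inj₂ (begin
    a               ≡⟨ m+n∸n≡m a 1 ⟨
    a + 1 ∸ 1       ≡⟨ cong (λ d → a + d ∸ 1) n∸a≡ ⟨
    a + (n ∸ a) ∸ 1 ≡⟨ cong (_∸ 1) (m+[n∸m]≡n a≤n) ⟩
    n ∸ 1           ∎)
    where open ≡-Reasoning
  ... | suc (suc _) with n∸a≤1
  ...   | s≤s ()

  iter-+ : ∀ i j f (x : List ℕ) → iter (i + j) f x ≡ iter i f (iter j f x)
  iter-+ zero    j f x = refl
  iter-+ (suc i) j f x = cong f (iter-+ i j f x)

  iter-sucʳ : ∀ i f (x : List ℕ) → iter (suc i) f x ≡ iter i f (f x)
  iter-sucʳ zero    f x = refl
  iter-sucʳ (suc i) f x = cong f (iter-sucʳ i f x)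

  iter-comm : ∀ i j f (x : List ℕ) → iter i f (iter j f x) ≡ iter j f (iter i f x)
  iter-comm i j f x = trans (sym (iter-+ i j f x)) (trans (cong (λ k → iter k f x) (+-comm i j)) (iter-+ j i f x))

  iter-closed : ∀ {S : List ℕ → Set} {f} → (∀ {x} → S x → S (f x)) → ∀ i {x} → S x → S (iter i f x)
  iter-closed         f-closed zero    Sx = Sx
  iter-closed {S = S} f-closed (suc i) Sx = f-closed (iter-closed {S = S} f-closed i Sx)

  module _ {S : List ℕ → Set} {f : List ℕ → List ℕ}
           (f-closed : ∀ {x} → S x → S (f x))
           (f-injective : ∀ {x y} → S x → S y → f x ≡ f y → x ≡ y) where

    private
      S-iter : ∀ i {x} → S x → S (iter i f x)
      S-iter = iter-closed {S = S} f-closed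

    iter-injective : ∀ i {x y} → S x → S y → iter i f x ≡ iter i f y → x ≡ y
    iter-injective zero    _  _  eq = eq
    iter-injective (suc i) Sx Sy eq = iter-injective i Sx Sy (f-injective (S-iter i Sx) (S-iter i Sy) eq)

    iter-returns : ∀ (xs : List (List ℕ)) → (∀ {x} → S x → x ∈ xs) →
                   ∀ {x} → S x → ∃[ p ] (1 ≤ p × p ≤ length xs × iter p f x ≡ x)
    iter-returns xs S⊆xs {x} Sx with pigeonhole (n<1+n (length xs)) (λ i → Any.index (S⊆xs (S-iter (toℕ i) Sx)))
    ... | i , j , i<j , same-position =
        toℕ j ∸ toℕ i , m<n⇒0<n∸m i<j , ≤-trans (m∸n≤m (toℕ j) (toℕ i)) (≤-pred (toℕ<n j)) , sym returns
      where
      at : ∀ k → iter k f x ≡ lookup xs (Any.index (S⊆xs (S-iter k Sx)))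
      at k = lookup-index (S⊆xs (S-iter k Sx))
      returns : x ≡ iter (toℕ j ∸ toℕ i) f x
      returns = iter-injective (toℕ i) Sx (S-iter (toℕ j ∸ toℕ i) Sx) (begin
        iter (toℕ i) f x                          ≡⟨ at (toℕ i) ⟩
        lookup xs _                               ≡⟨ cong (lookup xs) same-position ⟩
        lookup xs _                               ≡⟨ at (toℕ j) ⟨
        iter (toℕ j) f x                          ≡⟨ cong (λ k → iter k f x) (m+[n∸m]≡n (<⇒≤ i<j)) ⟨
        iter (toℕ i + (toℕ j ∸ toℕ i)) f x        ≡⟨ iter-+ (toℕ i) (toℕ j ∸ toℕ i) f x ⟩
        iter (toℕ i) f (iter (toℕ j ∸ toℕ i) f x) ∎)
        where open ≡-Reasoning

  SameOrbit-iter : ∀ i {σ ρ} → SameOrbit (iter i topdrop σ) ρ → SameOrbit σ ρ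
  SameOrbit-iter i {σ} (j , σi+j≡ρ) = j + i , trans (iter-+ j i topdrop σ) σi+j≡ρ

  reverse-topdrop : ∀ π → reverse (topdrop π) ≡ take (first π) π ++ reverse (drop (first π) π)
  reverse-topdrop π = begin
    reverse (drop a π ++ reverse (take a π))
      ≡⟨ reverse-++ (drop a π) (reverse (take a π)) ⟩
    reverse (reverse (take a π)) ++ reverse (drop a π)
      ≡⟨ cong (_++ reverse (drop a π)) (reverse-involutive (take a π)) ⟩
    take a π ++ reverse (drop a π)
      ∎
    where
    open ≡-Reasoning
    a : ℕ
    a = first π

  topdrop-reverse : ∀ σ → topdrop (reverse σ) ≡ reverse (topdropInv σ)
  topdrop-reverse σ = trans (sym (reverse-involutive _)) (cong reverse (reverse-topdrop (reverse σ)))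

  topdrop-↭ : ∀ π → topdrop π ↭ π
  topdrop-↭ π = begin
    drop a π ++ reverse (take a π) ↭⟨ ++-comm (drop a π) (reverse (take a π)) ⟩
    reverse (take a π) ++ drop a π ↭⟨ ++⁺ʳ (drop a π) (↭-reverse (take a π)) ⟩
    take a π ++ drop a π           ≡⟨ take++drop≡id a π ⟩
    π                              ∎
    where
    open PermutationReasoning
    a : ℕ
    a = first π

  topdrop≡reverse : ∀ π → length π ∸ first π ≤ 1 → topdrop π ≡ reverse π
  topdrop≡reverse π short = begin
    drop a π ++ reverse (take a π)           ≡⟨ cong (_++ reverse (take a π)) (reverse-length≤1 drop-short) ⟨
    reverse (drop a π) ++ reverse (take a π) ≡⟨ reverse-++ (take a π) (drop a π) ⟨
    reverse (take a π ++ drop a π)           ≡⟨ cong reverse (take++drop≡id a π) ⟩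
    reverse π                                ∎
    where
    open ≡-Reasoning
    a : ℕ
    a = first π
    drop-short : length (drop a π) ≤ 1
    drop-short = subst (_≤ 1) (sym (length-drop a π)) short

  topdrop-reverse-topdrop : ∀ {π} → 1 ≤ first π → first π ≤ length π →
                            topdrop (reverse (topdrop π)) ≡ reverse π
  topdrop-reverse-topdrop {π@(suc a′ ∷ _)} _ a≤length = begin
    topdrop (reverse (topdrop π))                         ≡⟨ cong topdrop (reverse-topdrop π) ⟩
    topdrop (take a π ++ reverse (drop a π))              ≡⟨⟩
    drop a (take a π ++ reverse (drop a π)) ++ reverse (take a (take a π ++ reverse (drop a π)))
      ≡⟨ cong₂ (λ l r → l ++ reverse r) (drop-take-++ a π _ a≤length) (take-take-++ a π _ a≤length) ⟩
    reverse (drop a π) ++ reverse (take a π)              ≡⟨ reverse-++ (take a π) (drop a π) ⟨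
    reverse (take a π ++ drop a π)                        ≡⟨ cong reverse (take++drop≡id a π) ⟩
    reverse π                                             ∎
    where
    open ≡-Reasoning
    a : ℕ
    a = suc a′

  module _ {n : ℕ} where

    InS-length : ∀ {π} → InS n π → length π ≡ n
    InS-length π↭ = trans (↭-length π↭) (length-applyUpTo suc n)

    InS-unique : ∀ {π} → InS n π → Unique π
    InS-unique π↭ = Unique-resp-↭ (↭⇒↭ₛ (↭-sym π↭)) (applyUpTo⁺₁ suc n (λ i<j _ → <⇒≢ i<j ∘ suc-injective))

    InS-bounds : ∀ {π x} → InS n π → x ∈ π → 1 ≤ x × x ≤ n
    InS-bounds π↭ x∈ with ∈-applyUpTo⁻ suc (∈-resp-↭ π↭ x∈)
    ... | _ , i<n , refl = s≤s z≤n , i<n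

    InS-topdrop : ∀ {π} → InS n π → InS n (topdrop π)
    InS-topdrop {π} π↭ = ↭-trans (topdrop-↭ π) π↭

    InS-reverse : ∀ {π} → InS n π → InS n (reverse π)
    InS-reverse {π} π↭ = ↭-trans (↭-reverse π) π↭

    InS-iter : ∀ i {π} → InS n π → InS n (iter i topdrop π)
    InS-iter = iter-closed {S = InS n} InS-topdrop

    InS⇒topdrop-reverse-topdrop : ∀ {π} → InS n π → topdrop (reverse (topdrop π)) ≡ reverse π
    InS⇒topdrop-reverse-topdrop {[]}     _  = refl
    InS⇒topdrop-reverse-topdrop {x ∷ xs} π↭ with InS-bounds π↭ (here refl)
    ... | 1≤x , x≤n = topdrop-reverse-topdrop 1≤x (subst (x ≤_) (sym (InS-length π↭)) x≤n)

    topdrop-injective : ∀ {π ρ} → InS n π → InS n ρ → topdrop π ≡ topdrop ρ → π ≡ ρ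
    topdrop-injective {π} {ρ} π↭ ρ↭ Tπ≡Tρ = reverse-injective (begin
      reverse π                     ≡⟨ InS⇒topdrop-reverse-topdrop π↭ ⟨
      topdrop (reverse (topdrop π)) ≡⟨ cong (topdrop ∘ reverse) Tπ≡Tρ ⟩
      topdrop (reverse (topdrop ρ)) ≡⟨ InS⇒topdrop-reverse-topdrop ρ↭ ⟩
      reverse ρ                     ∎)
      where open ≡-Reasoning

    iter-topdrop-injective : ∀ i {π ρ} → InS n π → InS n ρ → iter i topdrop π ≡ iter i topdrop ρ → π ≡ ρ
    iter-topdrop-injective = iter-injective InS-topdrop topdrop-injective

    iter-topdrop-reverse-iter : ∀ i {π} → InS n π → iter i topdrop (reverse (iter i topdrop π)) ≡ reverse π
    iter-topdrop-reverse-iter zero    _ = refl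
    iter-topdrop-reverse-iter (suc i) {π} π↭ = begin
      iter (suc i) topdrop (reverse (topdrop (iter i topdrop π)))
        ≡⟨ iter-sucʳ i topdrop _ ⟩
      iter i topdrop (topdrop (reverse (topdrop (iter i topdrop π))))
        ≡⟨ cong (iter i topdrop) (InS⇒topdrop-reverse-topdrop (InS-iter i π↭)) ⟩
      iter i topdrop (reverse (iter i topdrop π))
        ≡⟨ iter-topdrop-reverse-iter i π↭ ⟩
      reverse π
        ∎
      where open ≡-Reasoning

    IsTop⇒topdrop≡reverse : ∀ {π} → InS n π → IsTop n (first π) → topdrop π ≡ reverse π
    IsTop⇒topdrop≡reverse {π} π↭ top =
      topdrop≡reverse π (subst (λ l → l ∸ first π ≤ 1) (sym (InS-length π↭)) (IsTop⇒∸≤1 n top))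

    reverse-topdrop≡id⇒IsTop : ∀ {π} → InS n π → reverse (topdrop π) ≡ π → IsTop n (first π)
    reverse-topdrop≡id⇒IsTop {[]}        π↭ _    = inj₁ (InS-length π↭)
    reverse-topdrop≡id⇒IsTop {π@(a ∷ _)} π↭ rev≡ =
      ∸≤1⇒IsTop (proj₂ (InS-bounds π↭ (here refl)))
        (subst (λ l → l ∸ a ≤ 1) (InS-length π↭) (subst (_≤ 1) (length-drop a π) drop-short))
      where
      palindrome : reverse (drop a π) ≡ drop a π
      palindrome = ++-cancelˡ (take a π) _ _ (begin
        take a π ++ reverse (drop a π) ≡⟨ reverse-topdrop π ⟨
        reverse (topdrop π)            ≡⟨ rev≡ ⟩
        π                              ≡⟨ take++drop≡id a π ⟨
        take a π ++ drop a π           ∎)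
        where open ≡-Reasoning
      drop-short : length (drop a π) ≤ 1
      drop-short = unique-palindrome⇒length≤1 (drop⁺ a (InS-unique π↭)) palindrome

  module _ {π : List ℕ} (Tπ≡revπ : topdrop π ≡ reverse π) where

    iter-topdrop≡reverse-iter-topdropInv : ∀ j → iter (suc j) topdrop π ≡ reverse (iter j topdropInv π)
    iter-topdrop≡reverse-iter-topdropInv zero    = Tπ≡revπ
    iter-topdrop≡reverse-iter-topdropInv (suc j) =
      trans (cong topdrop (iter-topdrop≡reverse-iter-topdropInv j)) (topdrop-reverse (iter j topdropInv π))

    reverse-iter-topdrop≡iter-topdropInv : ∀ j → reverse (iter (suc j) topdrop π) ≡ iter j topdropInv π
    reverse-iter-topdrop≡iter-topdropInv j =
      trans (cong reverse (iter-topdrop≡reverse-iter-topdropInv j)) (reverse-involutive _)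

    Tpow-reflection : ∀ k → Tpow (ℤ.- k) π ≡ rev (Tpow (k ℤ.+ ℤ.+ 1) π)
    Tpow-reflection (ℤ.+ zero)   = sym (reverse-iter-topdrop≡iter-topdropInv 0)
    Tpow-reflection (ℤ.+ suc j)  = trans (sym (reverse-iter-topdrop≡iter-topdropInv (suc j)))
                                         (cong (λ i → reverse (iter i topdrop π)) (+-comm 1 (suc j)))
    Tpow-reflection -[1+ zero ]  = iter-topdrop≡reverse-iter-topdropInv 0
    Tpow-reflection -[1+ suc j ] = iter-topdrop≡reverse-iter-topdropInv (suc j)

  OrbitSize-unique : ∀ {π s t} → OrbitSize π s → OrbitSize π t → s ≡ t
  OrbitSize-unique (1≤s , πs≡π , s-minimal) (1≤t , πt≡π , t-minimal) with <-cmp _ _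
  ... | tri< s<t _ _ = contradiction πs≡π (t-minimal _ 1≤s s<t)
  ... | tri≈ _ s≡t _ = s≡t
  ... | tri> _ _ t<s = contradiction πt≡π (s-minimal _ 1≤t t<s)

  iter-reduce : ∀ {π s} → OrbitSize π s → ∀ j → ∃[ r ] (r < s × iter j topdrop π ≡ iter r topdrop π)
  iter-reduce (1≤s , _ , _) zero = 0 , 1≤s , refl
  iter-reduce {π} orbit@(1≤s , πs≡π , _) (suc j) with iter-reduce orbit j
  ... | r , r<s , πj≡πr with m≤n⇒m<n∨m≡n r<s
  ...   | inj₁ 1+r<s = suc r , 1+r<s , cong topdrop πj≡πr
  ...   | inj₂ 1+r≡s =
    0 , 1≤s , trans (cong topdrop πj≡πr) (trans (cong (λ i → iter i topdrop π) 1+r≡s) πs≡π)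

  module _ {n : ℕ} {π : List ℕ} (π↭ : InS n π) {s : ℕ} (orbit : OrbitSize π s) where

    private
      πs≡π : iter s topdrop π ≡ π
      πs≡π = proj₁ (proj₂ orbit)
      s-minimal : ∀ t → 1 ≤ t → t < s → iter t topdrop π ≢ π
      s-minimal = proj₂ (proj₂ orbit)

    OrbitSize-iter : ∀ i → OrbitSize (iter i topdrop π) s
    OrbitSize-iter i = proj₁ orbit , returns , minimal
      where
      returns : iter s topdrop (iter i topdrop π) ≡ iter i topdrop π
      returns = trans (iter-comm s i topdrop π) (cong (iter i topdrop) πs≡π)
      minimal : ∀ t → 1 ≤ t → t < s → iter t topdrop (iter i topdrop π) ≢ iter i topdrop π
      minimal t 1≤t t<s eq =
        s-minimal t 1≤t t<s (iter-topdrop-injective i (InS-iter t π↭) π↭ (trans (iter-comm i t topdrop π) eq))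

    iter-topdrop-distinct-below-OrbitSize : ∀ {a b} → a < b → b < s → iter a topdrop π ≢ iter b topdrop π
    iter-topdrop-distinct-below-OrbitSize {a} {b} a<b b<s πa≡πb =
      s-minimal (b ∸ a) (m<n⇒0<n∸m a<b) (≤-<-trans (m∸n≤m b a) b<s)
        (sym (iter-topdrop-injective a π↭ (InS-iter (b ∸ a) π↭) (begin
          iter a topdrop π                        ≡⟨ πa≡πb ⟩
          iter b topdrop π                        ≡⟨ cong (λ k → iter k topdrop π) (m+[n∸m]≡n (<⇒≤ a<b)) ⟨
          iter (a + (b ∸ a)) topdrop π            ≡⟨ iter-+ a (b ∸ a) topdrop π ⟩
          iter a topdrop (iter (b ∸ a) topdrop π) ∎)))
      where open ≡-Reasoning

    iter-injective-below-OrbitSize : ∀ {a b} → a < s → b < s → iter a topdrop π ≡ iter b topdrop π → a ≡ b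
    iter-injective-below-OrbitSize {a} {b} a<s b<s πa≡πb with <-cmp a b
    ... | tri< a<b _ _ = contradiction πa≡πb (iter-topdrop-distinct-below-OrbitSize a<b b<s)
    ... | tri≈ _ a≡b _ = a≡b
    ... | tri> _ _ b<a = contradiction (sym πa≡πb) (iter-topdrop-distinct-below-OrbitSize b<a a<s)

  -- The search bound n ! comes from iter-returns applied to the list of all permutations.
  -- Opaque because unfolding n ! during conversion checking is prohibitively expensive.
  opaque
    orbitSize : ℕ → List ℕ → ℕ
    orbitSize n π = suc (least (λ t → ≡-dec _≟_ (iter (suc t) topdrop π) π) (n !))

    orbitSize-correct : ∀ {n π} → InS n π → OrbitSize π (orbitSize n π)
    orbitSize-correct {n} {π} π↭
      with iter-returns InS-topdrop topdrop-injective (permutations (oneToN n)) ∈-permutations⁺ π↭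
    ... | suc t , _ , p≤n! , πp≡π = s≤s z≤n , least-satisfies returns? (n !) t<n! πp≡π , minimal
      where
      returns? : ∀ t → Dec (iter (suc t) topdrop π ≡ π)
      returns? t = ≡-dec _≟_ (iter (suc t) topdrop π) π
      t<n! : t < n !
      t<n! = subst (t <_) (trans (length-permutations (oneToN n)) (cong _! (length-applyUpTo suc n))) p≤n!
      minimal : ∀ t → 1 ≤ t → t < orbitSize n π → iter t topdrop π ≢ π
      minimal (suc t) _ (s≤s t<) = least-minimal returns? (n !) t<

  first-in-necklace : ∀ {P : ℕ → Set} {π s} → 1 ≤ s → P (first π) → Any P (necklace π s)
  first-in-necklace {s = suc _} _ Pπ₁ = here Pπ₁

  module TopOrbit {n : ℕ} (n≥2 : 2 ≤ n) {π : List ℕ} (π↭ : InS n π) (π-top : IsTop n (first π))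
                  {s : ℕ} (orbit : OrbitSize π s) where

    reverse-iter : ∀ i j → i + j ≡ s → reverse (iter (suc i) topdrop π) ≡ iter j topdrop π
    reverse-iter i j i+j≡s = iter-topdrop-injective i (InS-reverse (InS-iter (suc i) π↭)) (InS-iter j π↭) (begin
      iter i topdrop (reverse (iter (suc i) topdrop π))     ≡⟨ cong (iter i topdrop ∘ reverse) (iter-sucʳ i topdrop π) ⟩
      iter i topdrop (reverse (iter i topdrop (topdrop π))) ≡⟨ iter-topdrop-reverse-iter i (InS-topdrop π↭) ⟩
      reverse (topdrop π)                                   ≡⟨ cong reverse (IsTop⇒topdrop≡reverse π↭ π-top) ⟩
      reverse (reverse π)                                   ≡⟨ reverse-involutive π ⟩
      π                                                     ≡⟨ proj₁ (proj₂ orbit) ⟨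
      iter s topdrop π                                      ≡⟨ cong (λ k → iter k topdrop π) i+j≡s ⟨
      iter (i + j) topdrop π                                ≡⟨ iter-+ i j topdrop π ⟩
      iter i topdrop (iter j topdrop π)                     ∎)
      where open ≡-Reasoning

    size-even : ∃[ m ] s ≡ 2 * m
    size-even with even-or-odd s
    ... | inj₁ even         = even
    ... | inj₂ (m , s≡1+2m) =
      contradiction (unique-palindrome⇒length≤1 (InS-unique πm+1↭) palindrome) (<⇒≱ 2≤length)
      where
      πm+1↭ : InS n (iter (suc m) topdrop π)
      πm+1↭ = InS-iter (suc m) π↭
      palindrome : reverse (iter (suc m) topdrop π) ≡ iter (suc m) topdrop π
      palindrome = reverse-iter m (suc m) (trans (+-suc m m) (trans (cong suc (sym (2*m≡m+m m))) (sym s≡1+2m)))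
      2≤length : 2 ≤ length (iter (suc m) topdrop π)
      2≤length = subst (2 ≤_) (sym (InS-length πm+1↭)) n≥2

    module _ (m : ℕ) (s≡2m : s ≡ 2 * m) where

      private
        m+m≡s : m + m ≡ s
        m+m≡s = sym (trans s≡2m (2*m≡m+m m))

      0<half : 0 < m
      0<half = n≢0⇒n>0 λ m≡0 → n>0⇒n≢0 (proj₁ orbit) (trans s≡2m (cong (2 *_) m≡0))

      half<size : m < s
      half<size = subst (m <_) m+m≡s (m<m+n m 0<half)

      top-at-half : IsTop n (first (iter m topdrop π))
      top-at-half = reverse-topdrop≡id⇒IsTop (InS-iter m π↭) (reverse-iter m m m+m≡s)

      top-positions : ∀ {r} → r < s → IsTop n (first (iter r topdrop π)) → r ≡ 0 ⊎ r ≡ m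
      top-positions {zero}      _   _     = inj₁ refl
      top-positions {r@(suc _)} r<s r-top = inj₂ (*-cancelˡ-≡ r m 2 (begin
        2 * r       ≡⟨ 2*m≡m+m r ⟩
        r + r       ≡⟨ cong (r +_) r≡s∸r ⟩
        r + (s ∸ r) ≡⟨ m+[n∸m]≡n (<⇒≤ r<s) ⟩
        s           ≡⟨ s≡2m ⟩
        2 * m       ∎))
        where
        open ≡-Reasoning
        πr≡πs∸r : iter r topdrop π ≡ iter (s ∸ r) topdrop π
        πr≡πs∸r = begin
          iter r topdrop π                     ≡⟨ reverse-involutive _ ⟨
          reverse (reverse (iter r topdrop π)) ≡⟨ cong reverse (IsTop⇒topdrop≡reverse (InS-iter r π↭) r-top) ⟨
          reverse (iter (suc r) topdrop π)     ≡⟨ reverse-iter r (s ∸ r) (m+[n∸m]≡n (<⇒≤ r<s)) ⟩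
          iter (s ∸ r) topdrop π               ∎
        r≡s∸r : r ≡ s ∸ r
        r≡s∸r = iter-injective-below-OrbitSize π↭ orbit r<s (∸-monoʳ-< z<s (<⇒≤ r<s)) πr≡πs∸r

      countTop-necklace : countTop n (necklace π s) ≡ 2
      countTop-necklace = begin
        countTop n (necklace π s)     ≡⟨ length-filter-map (isTop? n) (λ i → first (iter i topdrop π)) (upTo s) ⟩
        length (filter top? (upTo s)) ≡⟨ length-unique-∼set (filter⁺ top? (upTo⁺ s)) 0,m-unique top-indices ⟩
        2                             ∎
        where
        open ≡-Reasoning
        top? : ∀ i → Dec (IsTop n (first (iter i topdrop π)))
        top? i = isTop? n (first (iter i topdrop π))
        0,m-unique : Unique (0 ∷ m ∷ [])
        0,m-unique = ((λ 0≡m → <-irrefl 0≡m 0<half) ∷ []) ∷ [] ∷ []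
        top-indices : ∀ {i} → i ∈ filter top? (upTo s) ⇔ i ∈ 0 ∷ m ∷ []
        top-indices = mk⇔ to from
          where
          to : ∀ {i} → i ∈ filter top? (upTo s) → i ∈ 0 ∷ m ∷ []
          to i∈ with ∈-filter⁻ top? i∈
          ... | i∈upTo , i-top with top-positions (∈-upTo⁻ i∈upTo) i-top
          ...   | inj₁ refl = here refl
          ...   | inj₂ refl = there (here refl)
          from : ∀ {i} → i ∈ 0 ∷ m ∷ [] → i ∈ filter top? (upTo s)
          from (here refl)         = ∈-filter⁺ top? (∈-upTo⁺ (proj₁ orbit)) π-top
          from (there (here refl)) = ∈-filter⁺ top? (∈-upTo⁺ half<size) top-at-half

    halves : ∃[ m ] (s ≡ 2 * m × IsTop n (first (iter m topdrop π)) × countTop n (necklace π s) ≡ 2)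
    halves with size-even
    ... | m , s≡2m = m , s≡2m , top-at-half m s≡2m , countTop-necklace m s≡2m

  necklace-even : ∀ {n σ s} → 2 ≤ n → InS n σ → OrbitSize σ s →
                  Any (IsTop n) (necklace σ s) → ∃[ m ] s ≡ 2 * m
  necklace-even n≥2 σ↭ orbit top∈ with find (Any.map⁻ top∈)
  ... | i , _ , i-top = TopOrbit.size-even n≥2 (InS-iter i σ↭) i-top (OrbitSize-iter σ↭ orbit i)

  -- Any decidable strict total order would do: it only selects one element of each pair {ρ, opposite ρ}.
  _<ₗ_ : Rel (List ℕ) 0ℓ
  _<ₗ_ = Lex-< _≡_ _<_

  _<ₗ?_ : Decidable _<ₗ_
  _<ₗ?_ = Lex.<-decidable _≟_ _<?_

  <ₗ-asym : Asymmetric _<ₗ_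
  <ₗ-asym = Lex.<-asymmetric sym (resp₂ _<_) <-asym

  <ₗ-connex : ∀ {x y} → x ≢ y → x <ₗ y ⊎ y <ₗ x
  <ₗ-connex {x} {y} x≢y with Lex.<-compare sym <-cmp x y
  ... | tri< x<y _ _ = inj₁ x<y
  ... | tri≈ _ x≋y _ = contradiction (Pointwise-≡⇒≡ x≋y) x≢y
  ... | tri> _ _ y<x = inj₂ y<x

  ∈-map-∷-permutations⁻ : ∀ {y : ℕ} {ys zs ρ} → y ∷ ys ↭ zs → ρ ∈ map (y ∷_) (permutations ys) →
                          ρ ↭ zs × first ρ ≡ y
  ∈-map-∷-permutations⁻ {ys = ys} y∷ys↭ ρ∈ with ∈-map⁻ _ ρ∈
  ... | ρ′ , ρ′∈ , refl = ↭-trans (↭-prep _ (∈-permutations⁻ ys ρ′∈)) y∷ys↭ , refl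

  ∈-map-∷-permutations⁺ : ∀ {y : ℕ} {ys zs ρ} → y ∷ ys ↭ zs → y ∷ ρ ↭ zs →
                          y ∷ ρ ∈ map (y ∷_) (permutations ys)
  ∈-map-∷-permutations⁺ y∷ys↭ y∷ρ↭ = ∈-map⁺ _ (∈-permutations⁺ (drop-∷ (↭-trans y∷ρ↭ (↭-sym y∷ys↭))))

  module Representatives (k : ℕ) where

    private
      n : ℕ
      n = suc (suc k)

      n≥2 : 2 ≤ n
      n≥2 = s≤s (s≤s z≤n)

      restₙ restₙ₋₁ : List ℕ
      restₙ   = oneToN (suc k)
      restₙ₋₁ = oneToN k ++ [ n ]

      n∷restₙ↭ : n ∷ restₙ ↭ oneToN n
      n∷restₙ↭ = subst (n ∷ restₙ ↭_) (applyUpTo-∷ʳ suc (suc k)) (∷↭∷ʳ n restₙ)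

      n-1∷restₙ₋₁↭ : suc k ∷ restₙ₋₁ ↭ oneToN n
      n-1∷restₙ₋₁↭ = subst (suc k ∷ restₙ₋₁ ↭_) oneToN≡ (↭-sym (shift (suc k) (oneToN k) [ n ]))
        where
        oneToN≡ : oneToN k ++ [ suc k ] ++ [ n ] ≡ oneToN n
        oneToN≡ = trans (sym (++-assoc (oneToN k) [ suc k ] [ n ]))
                        (trans (cong (_∷ʳ n) (applyUpTo-∷ʳ suc k)) (applyUpTo-∷ʳ suc (suc k)))

    topPermutations : List (List ℕ)
    topPermutations = map (n ∷_) (permutations restₙ) ++ map (suc k ∷_) (permutations restₙ₋₁)

    ∈-topPermutations⁻ : ∀ {ρ} → ρ ∈ topPermutations → InS n ρ × IsTop n (first ρ)
    ∈-topPermutations⁻ ρ∈ with ∈-++⁻ (map (n ∷_) (permutations restₙ)) ρ∈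
    ... | inj₁ ρ∈ₙ   with ∈-map-∷-permutations⁻ n∷restₙ↭ ρ∈ₙ
    ...   | ρ↭ , ρ₁≡n   = ρ↭ , inj₁ ρ₁≡n
    ∈-topPermutations⁻ ρ∈ | inj₂ ρ∈ₙ₋₁ with ∈-map-∷-permutations⁻ n-1∷restₙ₋₁↭ ρ∈ₙ₋₁
    ...   | ρ↭ , ρ₁≡n-1 = ρ↭ , inj₂ ρ₁≡n-1

    ∈-topPermutations⁺ : ∀ {ρ} → InS n ρ → IsTop n (first ρ) → ρ ∈ topPermutations
    ∈-topPermutations⁺ {[]}    ρ↭ _          = contradiction (InS-length {n} ρ↭) λ ()
    ∈-topPermutations⁺ {_ ∷ _} ρ↭ (inj₁ refl) = ∈-++⁺ˡ (∈-map-∷-permutations⁺ n∷restₙ↭ ρ↭)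
    ∈-topPermutations⁺ {_ ∷ _} ρ↭ (inj₂ refl) =
      ∈-++⁺ʳ (map (n ∷_) (permutations restₙ)) (∈-map-∷-permutations⁺ n-1∷restₙ₋₁↭ ρ↭)

    topPermutations-unique : Unique topPermutations
    topPermutations-unique = ++⁺ (with-head-unique n∷restₙ↭) (with-head-unique n-1∷restₙ₋₁↭) heads-differ
      where
      with-head-unique : ∀ {y ys} → y ∷ ys ↭ oneToN n → Unique (map (y ∷_) (permutations ys))
      with-head-unique y∷ys↭ =
        Unique-map⁺ ∷-injectiveʳ (permutations-unique _≟_ (AllPairs.tail (InS-unique y∷ys↭)))
      heads-differ : ∀ {ρ} → ¬ (ρ ∈ map (n ∷_) (permutations restₙ) × ρ ∈ map (suc k ∷_) (permutations restₙ₋₁))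
      heads-differ (ρ∈ₙ , ρ∈ₙ₋₁) with ∈-map⁻ _ ρ∈ₙ | ∈-map⁻ _ ρ∈ₙ₋₁
      ... | _ , _ , refl | _ , _ , eq = 1+n≢n (∷-injectiveˡ eq)

    length-topPermutations : length topPermutations ≡ 2 * suc k !
    length-topPermutations = begin
      length topPermutations
        ≡⟨ length-++ (map (n ∷_) (permutations restₙ)) ⟩
      length (map (n ∷_) (permutations restₙ)) + length (map (suc k ∷_) (permutations restₙ₋₁))
        ≡⟨ cong₂ _+_ (length-map (n ∷_) (permutations restₙ)) (length-map (suc k ∷_) (permutations restₙ₋₁)) ⟩
      length (permutations restₙ) + length (permutations restₙ₋₁)
        ≡⟨ cong₂ _+_ (length-permutations restₙ) (length-permutations restₙ₋₁) ⟩
      length restₙ ! + length restₙ₋₁ !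
        ≡⟨ cong₂ (λ a b → a ! + b !) (tail-length n∷restₙ↭) (tail-length n-1∷restₙ₋₁↭) ⟩
      suc k ! + suc k !
        ≡⟨ 2*m≡m+m (suc k !) ⟨
      2 * suc k !
        ∎
      where
      open ≡-Reasoning
      tail-length : ∀ {y ys} → y ∷ ys ↭ oneToN n → length ys ≡ suc k
      tail-length y∷ys↭ = suc-injective (InS-length y∷ys↭)

    opposite : List ℕ → List ℕ
    opposite ρ = iter (orbitSize n ρ / 2) topdrop ρ

    module _ {ρ : List ℕ} (ρ∈ : ρ ∈ topPermutations) where

      private
        ρ↭ : InS n ρ
        ρ↭ = proj₁ (∈-topPermutations⁻ ρ∈)
        ρ-top : IsTop n (first ρ)
        ρ-top = proj₂ (∈-topPermutations⁻ ρ∈)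
        orbit : OrbitSize ρ (orbitSize n ρ)
        orbit = orbitSize-correct ρ↭
        module ρ-orbit = TopOrbit n≥2 ρ↭ ρ-top orbit
        half : ℕ
        half = orbitSize n ρ / 2

        size≡2*half : orbitSize n ρ ≡ 2 * half
        size≡2*half with ρ-orbit.size-even
        ... | m , s≡2m = trans s≡2m (cong (2 *_) (sym (begin
          orbitSize n ρ / 2 ≡⟨ cong (_/ 2) s≡2m ⟩
          2 * m / 2         ≡⟨ cong (_/ 2) (*-comm 2 m) ⟩
          m * 2 / 2         ≡⟨ m*n/n≡m m 2 ⟩
          m                 ∎)))
          where open ≡-Reasoning

      opposite-∈ : opposite ρ ∈ topPermutations
      opposite-∈ = ∈-topPermutations⁺ (InS-iter half ρ↭) (ρ-orbit.top-at-half half size≡2*half)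

      opposite-≢ : opposite ρ ≢ ρ
      opposite-≢ opp≡ρ = <-irrefl (sym half≡0) (ρ-orbit.0<half half size≡2*half)
        where
        half≡0 : half ≡ 0
        half≡0 = iter-injective-below-OrbitSize ρ↭ orbit (ρ-orbit.half<size half size≡2*half) (proj₁ orbit) opp≡ρ

      opposite-involutive : opposite (opposite ρ) ≡ ρ
      opposite-involutive = begin
        iter (orbitSize n (opposite ρ) / 2) topdrop (opposite ρ)
          ≡⟨ cong (λ s → iter (s / 2) topdrop (opposite ρ)) same-size ⟩
        iter half topdrop (iter half topdrop ρ)
          ≡⟨ iter-+ half half topdrop ρ ⟨
        iter (half + half) topdrop ρ
          ≡⟨ cong (λ i → iter i topdrop ρ) (trans size≡2*half (2*m≡m+m half)) ⟨
        iter (orbitSize n ρ) topdrop ρ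
          ≡⟨ proj₁ (proj₂ orbit) ⟩
        ρ ∎
        where
        open ≡-Reasoning
        same-size : orbitSize n (opposite ρ) ≡ orbitSize n ρ
        same-size = OrbitSize-unique (orbitSize-correct (proj₁ (∈-topPermutations⁻ opposite-∈)))
                                     (OrbitSize-iter ρ↭ orbit half)

      top-in-orbit : ∀ {r} → r < orbitSize n ρ → IsTop n (first (iter r topdrop ρ)) →
                     iter r topdrop ρ ≡ ρ ⊎ iter r topdrop ρ ≡ opposite ρ
      top-in-orbit r<s r-top with ρ-orbit.top-positions half size≡2*half r<s r-top
      ... | inj₁ refl = inj₁ refl
      ... | inj₂ refl = inj₂ refl

    representatives : List (List ℕ)
    representatives = filter (λ ρ → ρ <ₗ? opposite ρ) topPermutations

    private
      ∈-representatives⁻ : ∀ {ρ} → ρ ∈ representatives → ρ ∈ topPermutations × ρ <ₗ opposite ρ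
      ∈-representatives⁻ = ∈-filter⁻ (λ ρ → ρ <ₗ? opposite ρ)

      ∈-representatives⁺ : ∀ {ρ} → ρ ∈ topPermutations → ρ <ₗ opposite ρ → ρ ∈ representatives
      ∈-representatives⁺ = ∈-filter⁺ (λ ρ → ρ <ₗ? opposite ρ)

    length-representatives : length representatives ≡ suc k !
    length-representatives = *-cancelˡ-≡ _ _ 2 (trans doubled length-topPermutations)
      where
      doubled : 2 * length representatives ≡ length topPermutations
      doubled = length-filter-≺-involution _<ₗ?_ <ₗ-asym <ₗ-connex topPermutations-unique
                  opposite-∈ opposite-involutive opposite-≢

    representatives-valid : All (λ ρ → InS n ρ × NecklaceHasTop n ρ) representatives
    representatives-valid = All.tabulate λ ρ∈ → valid (∈-topPermutations⁻ (proj₁ (∈-representatives⁻ ρ∈)))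
      where
      valid : ∀ {ρ} → InS n ρ × IsTop n (first ρ) → InS n ρ × NecklaceHasTop n ρ
      valid (ρ↭ , ρ-top) =
        ρ↭ , orbitSize n _ , orbitSize-correct ρ↭ , first-in-necklace (proj₁ (orbitSize-correct ρ↭)) ρ-top

    representatives-distinct : AllPairs (λ ρ ρ′ → ¬ SameOrbit ρ ρ′) representatives
    representatives-distinct = AllPairs-map-∈ different-orbits (filter⁺ _ topPermutations-unique)
      where
      different-orbits : ∀ {ρ ρ′} → ρ ∈ representatives → ρ′ ∈ representatives → ρ ≢ ρ′ → ¬ SameOrbit ρ ρ′
      different-orbits {ρ} {ρ′} ρ∈ ρ′∈ ρ≢ρ′ (j , ρj≡ρ′) with ∈-representatives⁻ ρ∈ | ∈-representatives⁻ ρ′∈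
      ... | ρ∈top , ρ<opp | ρ′∈top , ρ′<opp
          with iter-reduce (orbitSize-correct (proj₁ (∈-topPermutations⁻ ρ∈top))) j
      ...   | r , r<s , ρj≡ρr
            with top-in-orbit ρ∈top r<s (subst (IsTop n ∘ first) (trans (sym ρj≡ρ′) ρj≡ρr)
                                                (proj₂ (∈-topPermutations⁻ ρ′∈top)))
      ...     | inj₁ ρr≡ρ   = ρ≢ρ′ (trans (sym ρr≡ρ) (trans (sym ρj≡ρr) ρj≡ρ′))
      ...     | inj₂ ρr≡opp = <ₗ-asym ρ<opp (subst₂ _<ₗ_ ρ′≡opp opp-ρ′≡ρ ρ′<opp)
        where
        ρ′≡opp : ρ′ ≡ opposite ρ
        ρ′≡opp = trans (sym ρj≡ρ′) (trans ρj≡ρr ρr≡opp)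
        opp-ρ′≡ρ : opposite ρ′ ≡ ρ
        opp-ρ′≡ρ = trans (cong opposite ρ′≡opp) (opposite-involutive ρ∈top)

    representatives-cover : ∀ σ → InS n σ → NecklaceHasTop n σ → Any (SameOrbit σ) representatives
    representatives-cover σ σ↭ (_ , _ , top∈) with find (Any.map⁻ top∈)
    ... | i , _ , i-top = Any.map (SameOrbit-iter i) (represented (∈-topPermutations⁺ (InS-iter i σ↭) i-top))
      where
      represented : ∀ {ρ} → ρ ∈ topPermutations → Any (SameOrbit ρ) representatives
      represented {ρ} ρ∈ with ρ <ₗ? opposite ρ
      ... | yes ρ<opp = lose (∈-representatives⁺ ρ∈ ρ<opp) (0 , refl)
      ... | no  ρ≮opp with <ₗ-connex (opposite-≢ ρ∈ ∘ sym)
      ...   | inj₁ ρ<opp = contradiction ρ<opp ρ≮opp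
      ...   | inj₂ opp<ρ = lose (∈-representatives⁺ (opposite-∈ ρ∈) opp<opp-opp) (orbitSize n ρ / 2 , refl)
        where
        opp<opp-opp : opposite ρ <ₗ opposite (opposite ρ)
        opp<opp-opp = subst (opposite ρ <ₗ_) (sym (opposite-involutive ρ∈)) opp<ρ

open Topdrop using (Tpow-reflection; IsTop⇒topdrop≡reverse; module TopOrbit; necklace-even; module Representatives)

open import Defs
open import Data.Nat using (ℕ; _≤_; _*_; _∸_)
open import Data.Nat using (_!)
open import Data.Integer using (ℤ; _+_; -_; +_)
open import Data.List using (List; length)
open import Data.List.Relation.Unary.Any using (Any)
open import Data.List.Relation.Unary.All using (All)
open import Data.List.Relation.Unary.AllPairs using (AllPairs)
open import Data.Product using (Σ; _×_; ∃-syntax)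
open import Relation.Nullary using (¬_)
open import Relation.Binary.PropositionalEquality using (_≡_)
open import Data.Nat using (zero; suc; s≤s)
open import Data.Product using (_,_)

theorem3p7 : (n : ℕ) → 2 ≤ n →
    ((π : List ℕ) → InS n π → IsTop n (first π) →
        -- (1)
        ((k : ℤ) → Tpow (- k) π ≡ rev (Tpow (k + + 1) π))
      -- (2) and (3)
      × ((s : ℕ) → OrbitSize π s →
           ∃[ m ] (s ≡ 2 * m
                   × IsTop n (first (iter m topdrop π))
                   × countTop n (necklace π s) ≡ 2)))
    -- (2), necklace form: a topdrop-valid necklace containing n and/or n-1 has even size
    × ((σ : List ℕ) → InS n σ → (s : ℕ) → OrbitSize σ s →
         Any (IsTop n) (necklace σ s) → ∃[ m ] s ≡ 2 * m)
    -- (4): exactly (n-1)! orbits whose necklaces contain n and/or n-1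
    × (Σ (List (List ℕ)) λ reps →
         (length reps ≡ (n ∸ 1) !)
         × All (λ ρ → InS n ρ × NecklaceHasTop n ρ) reps
         × AllPairs (λ ρ ρ' → ¬ SameOrbit ρ ρ') reps
         × ((σ : List ℕ) → InS n σ → NecklaceHasTop n σ → Any (SameOrbit σ) reps))
theorem3p7 (suc (suc k)) n≥2 =
    (λ π π↭ π-top → Tpow-reflection (IsTop⇒topdrop≡reverse π↭ π-top)
                  , λ _ orbit → TopOrbit.halves n≥2 π↭ π-top orbit)
  , (λ σ σ↭ _ orbit → necklace-even n≥2 σ↭ orbit)
  , representatives , length-representatives , representatives-valid , representatives-distinct , representatives-cover
  where open Representatives k
theorem3p7 (suc zero) (s≤s ())
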